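{- Every line of $\mathrm{PG}(5,q)$ of minimum rank $2$ is contained in a plane of $\mathrm{PG}(5,q)$ of minimum rank $2$.
   Context: Identify points of $\mathrm{PG}(5,q)$ with nonzero symmetric $3\times3$ matrices over $\mathbb{F}_q$ up to nonzero scalars; projective subspaces correspond to $\mathbb{F}_q$-subspaces of symmetric matrices. The rank of a point is the rank of its matrix; a subspace has minimum rank $d$ if the smallest rank of its points is $d$. -}

module Defs where

open import Level using (0ℓ)
open import Data.Nat using (ℕ; _≤_)
open import Data.Fin using (Fin; zero; suc)
open import Data.Product using (Σ; ∃; _×_; _,_)
open import Data.List using (List)
open import Data.List.Membership.Propositional using (_∈_)
open import Relation.Binary.PropositionalEquality using (_≡_; _≢_)
open import Relation.Binary.Definitions using (DecidableEquality)
open import Relation.Nullary using (yes; no; ¬_)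
open import Algebra.Structures using (IsCommutativeRing)

-- A finite field (every finite field is some F_q, q a prime power),
-- with propositional equality as the field equality.
record FiniteField : Set₁ where
  infixl 6 _+_
  infixl 7 _*_
  field
    F       : Set
    _+_ _*_ : F → F → F
    -_      : F → F
    0# 1#   : F
    isCommutativeRing : IsCommutativeRing _≡_ _+_ _*_ -_ 0# 1#
    _≟_     : DecidableEquality F
    0≢1     : 0# ≢ 1#
    inverse : ∀ x → x ≢ 0# → Σ F (λ y → x * y ≡ 1#)
    elements : List F
    complete : ∀ x → x ∈ elements

module Over (K : FiniteField) where
  open FiniteField K

  -- Vectors of F_q^6, identified with symmetric 3x3 matrices
  --   [ v0 v1 v2 ]
  --   [ v1 v3 v4 ]
  --   [ v2 v4 v5 ]
  V : Set
  V = Fin 6 → F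

  e : V → Fin 3 → Fin 3 → F
  e v zero zero = v zero
  e v zero (suc zero) = v (suc zero)
  e v zero (suc (suc zero)) = v (suc (suc zero))
  e v (suc zero) zero = v (suc zero)
  e v (suc zero) (suc zero) = v (suc (suc (suc zero)))
  e v (suc zero) (suc (suc zero)) = v (suc (suc (suc (suc zero))))
  e v (suc (suc zero)) zero = v (suc (suc zero))
  e v (suc (suc zero)) (suc zero) = v (suc (suc (suc (suc zero))))
  e v (suc (suc zero)) (suc (suc zero)) = v (suc (suc (suc (suc (suc zero)))))

  minor2 : V → Fin 3 → Fin 3 → Fin 3 → Fin 3 → F
  minor2 v i i' j j' = e v i j * e v i' j' + - (e v i j' * e v i' j)

  det : V → F
  det v = e v zero zero * minor2 v (suc zero) (suc (suc zero)) (suc zero) (suc (suc zero))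
        + - (e v zero (suc zero) * minor2 v (suc zero) (suc (suc zero)) zero (suc (suc zero)))
        + e v zero (suc (suc zero)) * minor2 v (suc zero) (suc (suc zero)) zero (suc zero)

  -- Rank (determinantal rank: the largest k such that some k×k minor is nonzero).
  -- The matrix is zero (rank 0)
  RankZero : V → Set
  RankZero v = ∀ i j → e v i j ≡ 0#
  Minors2Zero : V → Set
  Minors2Zero v = ∀ i i' j j' → minor2 v i i' j j' ≡ 0#

  data Rank (v : V) : ℕ → Set where
    rank0 : RankZero v → Rank v 0
    rank1 : ¬ RankZero v → Minors2Zero v → Rank v 1
    rank2 : ¬ Minors2Zero v → det v ≡ 0# → Rank v 2
    rank3 : det v ≢ 0# → Rank v 3

  NonZero : V → Set
  NonZero v = ∃ λ i → v i ≢ 0#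

  lc : ∀ {k} → (Fin k → F) → (Fin k → V) → V
  lc {ℕ.zero} c g i = 0#
  lc {ℕ.suc k} c g i = c zero * g zero i + lc (λ j → c (suc j)) (λ j → g (suc j)) i

  LinIndep : ∀ {k} → (Fin k → V) → Set
  LinIndep g = ∀ c → (∀ i → lc c g i ≡ 0#) → ∀ j → c j ≡ 0#

  InSpan : ∀ {k} → V → (Fin k → V) → Set
  InSpan v g = ∃ λ c → ∀ i → v i ≡ lc c g i

  MinRank : ∀ {k} → (Fin k → V) → ℕ → Set
  MinRank g d =
    (∀ c r → NonZero (lc c g) → Rank (lc c g) r → d ≤ r)
    × (∃ λ c → NonZero (lc c g) × Rank (lc c g) d)

{-# OPTIONS --safe #-}

-- Let A, B span the line. If X is a matrix such that no X + aA + bB has rank ≤ 1, then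
-- ⟨X, A, B⟩ is a plane of minimum rank 2, since its points off the line are multiples of such
-- matrices. Every matrix of rank ≤ 1 is l·wwᵀ with w one of the q² + q + 1 normalised vectors
-- of F_q³, so at most q(q² + q + 1)·q² < q⁶ matrices X fail, and a suitable X exists.

module Submission where

open import Defs
open import Level using (0ℓ)
open import Data.Fin using (Fin; zero; suc)
open import Data.Fin.Patterns using (0F; 1F; 2F; 3F; 4F; 5F)
open import Data.Product using (∃; ∃₂; _×_; _,_)
open import Data.Nat using (ℕ; zero; suc; _≤_; _<_; z≤n; s≤s)
import Data.Nat as Nat
import Data.Nat.Properties as ℕₚ
open ℕₚ using (module ≤-Reasoning)
open import Data.Nat.Tactic.RingSolver using (solve-∀)
open import Data.List using (List; []; _∷_; _++_; map; length; cartesianProductWith; deduplicate)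
open import Data.List.Properties using (length-++; length-map; length-removeAt′)
open import Data.List.Relation.Unary.Any using (Any; here; there; index; any?; satisfied)
open import Data.List.Membership.Propositional using (_∈_; _─_; find; lose)
open import Data.List.Relation.Binary.Subset.Propositional using (_⊆_)
open import Data.List.Relation.Unary.Unique.Propositional using (Unique)
open import Data.List.Relation.Unary.All using (All)
import Data.List.Relation.Unary.All as All
open import Data.List.Relation.Unary.All.Properties using (¬All⇒Any¬)
open import Data.List.Relation.Unary.AllPairs using ([]; _∷_)
open import Data.List.Relation.Unary.Unique.Propositional.Properties using (cartesianProductWith⁺)
open import Data.List.Relation.Unary.Unique.DecPropositional.Properties using (deduplicate-!)
open import Data.List.Membership.Propositional.Properties
  using (∈-cartesianProductWith⁺; ∈-deduplicate⁺; ∈-++⁺ˡ; ∈-++⁺ʳ; ∈-map⁺)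
open import Data.Vec using (Vec; []; _∷_; lookup; tabulate)
open import Data.Vec.Properties using (∷-injective; lookup∘tabulate; tabulate∘lookup; tabulate-cong)
open import Data.Vec.Functional using () renaming (_∷_ to _∷ᶠ_)
open import Relation.Binary.PropositionalEquality
open import Relation.Nullary using (¬_; Dec; yes; no)
open import Data.Fin.Properties using (all?)
open import Algebra.Bundles using (CommutativeRing)
open import Data.Empty using (⊥-elim)
open import Function using (_∘_)

module _ {A : Set} where

  ∈-─ : ∀ {x y : A} {ys} (x∈ys : x ∈ ys) → y ∈ ys → x ≢ y → y ∈ ys ─ x∈ys
  ∈-─ (here refl) (here refl) x≢y = ⊥-elim (x≢y refl)
  ∈-─ (here _)    (there y∈ys) _  = y∈ys
  ∈-─ (there _)   (here refl) _   = here refl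
  ∈-─ (there x∈ys) (there y∈ys) x≢y = there (∈-─ x∈ys y∈ys x≢y)

  Unique-⊆⇒length-≤ : ∀ {xs ys : List A} → Unique xs → xs ⊆ ys → length xs ≤ length ys
  Unique-⊆⇒length-≤ {[]} _ _ = z≤n
  Unique-⊆⇒length-≤ {x ∷ xs} {ys} (x∉xs ∷ xs!) xs⊆ys = begin
    suc (length xs)           ≤⟨ s≤s (Unique-⊆⇒length-≤ xs! xs⊆ys─x) ⟩
    suc (length (ys ─ x∈ys))  ≡⟨ length-removeAt′ ys (index x∈ys) ⟨
    length ys                 ∎
    where
    open ≤-Reasoning
    x∈ys : x ∈ ys
    x∈ys = xs⊆ys (here refl)
    xs⊆ys─x : xs ⊆ ys ─ x∈ys
    xs⊆ys─x y∈xs = ∈-─ x∈ys (xs⊆ys (there y∈xs)) (All.lookup x∉xs y∈xs)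

module _ where
  open Nat using (_+_; _*_; _^_)

  length-cartesianProductWith : ∀ {A B C : Set} (f : A → B → C) xs ys →
    length (cartesianProductWith f xs ys) ≡ length xs * length ys
  length-cartesianProductWith f []       ys = refl
  length-cartesianProductWith f (x ∷ xs) ys = begin
    length (map (f x) ys ++ cartesianProductWith f xs ys)
      ≡⟨ length-++ (map (f x) ys) ⟩
    length (map (f x) ys) + length (cartesianProductWith f xs ys)
      ≡⟨ cong₂ _+_ (length-map (f x) ys) (length-cartesianProductWith f xs ys) ⟩
    length ys + length xs * length ys ∎
    where open ≡-Reasoning

  module _ {A : Set} (xs : List A) where

    vectors : ∀ n → List (Vec A n)
    vectors zero    = [] ∷ []
    vectors (suc n) = cartesianProductWith _∷_ xs (vectors n)

    length-vectors : ∀ n → length (vectors n) ≡ length xs ^ n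
    length-vectors zero    = refl
    length-vectors (suc n) =
      trans (length-cartesianProductWith _∷_ xs (vectors n)) (cong (length xs *_) (length-vectors n))

    vectors-unique : Unique xs → ∀ n → Unique (vectors n)
    vectors-unique xs! zero    = All.[] ∷ []
    vectors-unique xs! (suc n) = cartesianProductWith⁺ _∷_ ∷-injective xs! (vectors-unique xs! n)

    ∈-vectors : (∀ x → x ∈ xs) → ∀ {n} (v : Vec A n) → v ∈ vectors n
    ∈-vectors ∈xs []      = here refl
    ∈-vectors ∈xs (x ∷ v) = ∈-cartesianProductWith⁺ _∷_ (∈xs x) (∈-vectors ∈xs v)

  q²+q+1<q³ : ∀ {q} → 2 ≤ q → q * q + (q + 1) < q * (q * q)
  q²+q+1<q³ {q} 2≤q = begin-strict
    q * q + (q + 1)  <⟨ ℕₚ.+-monoʳ-< (q * q) (ℕₚ.+-monoʳ-< q 2≤q) ⟩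
    q * q + (q + q)  ≤⟨ ℕₚ.+-monoʳ-≤ (q * q) 2q≤q² ⟩
    q * q + q * q    ≡⟨ double (q * q) ⟨
    2 * (q * q)      ≤⟨ ℕₚ.*-monoˡ-≤ (q * q) 2≤q ⟩
    q * (q * q)      ∎
    where
    open ≤-Reasoning
    double : ∀ m → 2 * m ≡ m + m
    double m = cong (m +_) (ℕₚ.+-identityʳ m)
    2q≤q² : q + q ≤ q * q
    2q≤q² = subst (_≤ q * q) (double q) (ℕₚ.*-monoˡ-≤ q 2≤q)

  q³+q²+q·qᵏ<q⁶ : ∀ {q k} → 2 ≤ q → k ≤ 2 → q * (q * q + (q + 1)) * q ^ k < q ^ 6
  q³+q²+q·qᵏ<q⁶ {q@(suc _)} {k} 2≤q k≤2 = begin-strict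
    q * (q * q + (q + 1)) * q ^ k  ≤⟨ ℕₚ.*-monoʳ-≤ (q * (q * q + (q + 1))) (ℕₚ.^-monoʳ-≤ q k≤2) ⟩
    q * (q * q + (q + 1)) * q ^ 2  <⟨ ℕₚ.*-monoˡ-< (q ^ 2) (ℕₚ.*-monoʳ-< q (q²+q+1<q³ 2≤q)) ⟩
    q * (q * (q * q)) * q ^ 2      ≡⟨ q⁴q²≡q⁶ q ⟩
    q ^ 6                          ∎
    where
    open ≤-Reasoning
    q⁴q²≡q⁶ : ∀ q → q * (q * (q * q)) * (q * (q * 1)) ≡ q * (q * (q * (q * (q * (q * 1)))))
    q⁴q²≡q⁶ = solve-∀

module _ (K : FiniteField) where
  open FiniteField K
  open Over K

  commutativeRing : CommutativeRing 0ℓ 0ℓ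
  commutativeRing = record { isCommutativeRing = isCommutativeRing }

  open CommutativeRing commutativeRing
    using ( +-identityˡ; +-identityʳ; *-identityˡ; *-identityʳ; *-comm; *-assoc
          ; zeroˡ; zeroʳ; distribˡ; +-group)
  open import Algebra.Properties.Group +-group
    using (x∙y⁻¹≈ε⇒x≈y; x≈y⇒x∙y⁻¹≈ε; //-rightDividesʳ)
  open import Algebra.Solver.Ring.NaturalCoefficients.Default
    (CommutativeRing.commutativeSemiring commutativeRing) using (solve; _:=_; _:*_; con)

  nonzero-cancel : ∀ {x y} → x ≢ 0# → x * y ≡ 0# → y ≡ 0#
  nonzero-cancel {x} {y} x≢0 xy≡0 with inverse x x≢0
  ... | x⁻¹ , xx⁻¹≡1 = begin
    y                 ≡⟨ *-identityˡ y ⟨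
    1# * y            ≡⟨ cong (_* y) xx⁻¹≡1 ⟨
    (x * x⁻¹) * y     ≡⟨ solve 3 (λ a b c → (a :* b) :* c := b :* (a :* c)) refl x x⁻¹ y ⟩
    x⁻¹ * (x * y)     ≡⟨ cong (x⁻¹ *_) xy≡0 ⟩
    x⁻¹ * 0#          ≡⟨ zeroʳ x⁻¹ ⟩
    0#                ∎
    where open ≡-Reasoning

  square≡0⇒≡0 : ∀ x → x * x ≡ 0# → x ≡ 0#
  square≡0⇒≡0 x xx≡0 with x ≟ 0#
  ... | yes x≡0 = x≡0
  ... | no x≢0  = ⊥-elim (x≢0 (nonzero-cancel x≢0 xx≡0))

  0*x+y≡y : ∀ x y → 0# * x + y ≡ y
  0*x+y≡y x y = trans (cong (_+ y) (zeroˡ x)) (+-identityˡ y)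

  ab≡cc⇒a≡0⇒c≡0 : ∀ {a b c} → a * b ≡ c * c → a ≡ 0# → c ≡ 0#
  ab≡cc⇒a≡0⇒c≡0 {a} {b} {c} ab≡cc a≡0 =
    square≡0⇒≡0 c (trans (sym ab≡cc) (trans (cong (_* b) a≡0) (zeroˡ b)))

  entryIndex : Fin 3 → Fin 3 → Fin 6
  entryIndex 0F 0F = 0F
  entryIndex 0F 1F = 1F
  entryIndex 0F 2F = 2F
  entryIndex 1F 0F = 1F
  entryIndex 1F 1F = 3F
  entryIndex 1F 2F = 4F
  entryIndex 2F 0F = 2F
  entryIndex 2F 1F = 4F
  entryIndex 2F 2F = 5F

  e≡entryIndex : ∀ v i j → e v i j ≡ v (entryIndex i j)
  e≡entryIndex v 0F 0F = refl
  e≡entryIndex v 0F 1F = refl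
  e≡entryIndex v 0F 2F = refl
  e≡entryIndex v 1F 0F = refl
  e≡entryIndex v 1F 1F = refl
  e≡entryIndex v 1F 2F = refl
  e≡entryIndex v 2F 0F = refl
  e≡entryIndex v 2F 1F = refl
  e≡entryIndex v 2F 2F = refl

  e-cong : ∀ {v w} → v ≗ w → ∀ i j → e v i j ≡ e w i j
  e-cong {v} {w} v≗w i j = trans (e≡entryIndex v i j) (trans (v≗w _) (sym (e≡entryIndex w i j)))

  e-scale : ∀ y v i j → e (λ k → y * v k) i j ≡ y * e v i j
  e-scale y v i j = trans (e≡entryIndex _ i j) (cong (y *_) (sym (e≡entryIndex v i j)))

  minor2-cong : ∀ {v w} → v ≗ w → ∀ i i' j j' → minor2 v i i' j j' ≡ minor2 w i i' j j'
  minor2-cong v≗w i i' j j' =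
    cong₂ _+_ (cong₂ _*_ (e-cong v≗w i j) (e-cong v≗w i' j'))
              (cong -_ (cong₂ _*_ (e-cong v≗w i j') (e-cong v≗w i' j)))

  det-cong : ∀ {v w} → v ≗ w → det v ≡ det w
  det-cong v≗w =
    cong₂ _+_ (cong₂ _+_ (cong₂ _*_ (e-cong v≗w 0F 0F) (minor2-cong v≗w 1F 2F 1F 2F))
                         (cong -_ (cong₂ _*_ (e-cong v≗w 0F 1F) (minor2-cong v≗w 1F 2F 0F 2F))))
              (cong₂ _*_ (e-cong v≗w 0F 2F) (minor2-cong v≗w 1F 2F 0F 1F))

  RankZero-resp : ∀ {v w} → v ≗ w → RankZero v → RankZero w
  RankZero-resp v≗w v≡0 i j = trans (sym (e-cong v≗w i j)) (v≡0 i j)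

  Minors2Zero-resp : ∀ {v w} → v ≗ w → Minors2Zero v → Minors2Zero w
  Minors2Zero-resp v≗w m i i' j j' = trans (sym (minor2-cong v≗w i i' j j')) (m i i' j j')

  NonZero-resp : ∀ {v w} → v ≗ w → NonZero v → NonZero w
  NonZero-resp v≗w (i , vᵢ≢0) = i , λ wᵢ≡0 → vᵢ≢0 (trans (v≗w i) wᵢ≡0)

  Rank-resp : ∀ {v w r} → v ≗ w → Rank v r → Rank w r
  Rank-resp v≗w (rank0 z)    = rank0 (RankZero-resp v≗w z)
  Rank-resp v≗w (rank1 nz m) = rank1 (λ z → nz (RankZero-resp (sym ∘ v≗w) z)) (Minors2Zero-resp v≗w m)
  Rank-resp v≗w (rank2 nm d) =
    rank2 (λ m → nm (Minors2Zero-resp (sym ∘ v≗w) m)) (trans (sym (det-cong v≗w)) d)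
  Rank-resp v≗w (rank3 d)    = rank3 (λ d' → d (trans (det-cong v≗w) d'))

  RankZero⇒Minors2Zero : ∀ {v} → RankZero v → Minors2Zero v
  RankZero⇒Minors2Zero v≡0 i i' j j' = x≈y⇒x∙y⁻¹≈ε
    (trans (cong₂ _*_ (v≡0 i j) (v≡0 i' j')) (sym (cong₂ _*_ (v≡0 i j') (v≡0 i' j))))

  zero⇒Minors2Zero : ∀ {v} → (∀ k → v k ≡ 0#) → Minors2Zero v
  zero⇒Minors2Zero {v} v≡0 = RankZero⇒Minors2Zero λ i j → trans (e≡entryIndex v i j) (v≡0 _)

  Minors2Zero-scale : ∀ y {v} → Minors2Zero v → Minors2Zero (λ k → y * v k)
  Minors2Zero-scale y {v} m i i' j j' = x≈y⇒x∙y⁻¹≈ε (begin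
    e yv i j * e yv i' j'              ≡⟨ cong₂ _*_ (e-scale y v i j) (e-scale y v i' j') ⟩
    (y * e v i j) * (y * e v i' j')    ≡⟨ scale² _ _ ⟩
    (y * y) * (e v i j * e v i' j')    ≡⟨ cong ((y * y) *_) (x∙y⁻¹≈ε⇒x≈y _ _ (m i i' j j')) ⟩
    (y * y) * (e v i j' * e v i' j)    ≡⟨ scale² _ _ ⟨
    (y * e v i j') * (y * e v i' j)    ≡⟨ cong₂ _*_ (e-scale y v i j') (e-scale y v i' j) ⟨
    e yv i j' * e yv i' j              ∎)
    where
    open ≡-Reasoning
    yv : V
    yv k = y * v k
    scale² : ∀ a b → (y * a) * (y * b) ≡ (y * y) * (a * b)
    scale² = solve 3 (λ t a b → (t :* a) :* (t :* b) := (t :* t) :* (a :* b)) refl y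

  ¬Minors2Zero⇒rank≥2 : ∀ {v r} → ¬ Minors2Zero v → Rank v r → 2 ≤ r
  ¬Minors2Zero⇒rank≥2 ¬m (rank0 z)   = ⊥-elim (¬m (RankZero⇒Minors2Zero z))
  ¬Minors2Zero⇒rank≥2 ¬m (rank1 _ m) = ⊥-elim (¬m m)
  ¬Minors2Zero⇒rank≥2 _  (rank2 _ _) = s≤s (s≤s z≤n)
  ¬Minors2Zero⇒rank≥2 _  (rank3 _)   = s≤s (s≤s z≤n)

  lc-cong : ∀ {k} {c c' : Fin k → F} (g : Fin k → V) → c ≗ c' → lc c g ≗ lc c' g
  lc-cong {zero}  g c≗c' i = refl
  lc-cong {suc k} g c≗c' i =
    cong₂ _+_ (cong (_* g zero i) (c≗c' zero)) (lc-cong (g ∘ suc) (c≗c' ∘ suc) i)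

  lc-scale : ∀ {k} y (c : Fin k → F) (g : Fin k → V) i → y * lc c g i ≡ lc (λ j → y * c j) g i
  lc-scale {zero}  y c g i = zeroʳ y
  lc-scale {suc k} y c g i = begin
    y * (c zero * g zero i + lc (c ∘ suc) (g ∘ suc) i)
      ≡⟨ distribˡ y _ _ ⟩
    y * (c zero * g zero i) + y * lc (c ∘ suc) (g ∘ suc) i
      ≡⟨ cong₂ _+_ (sym (*-assoc y _ _)) (lc-scale y (c ∘ suc) (g ∘ suc) i) ⟩
    (y * c zero) * g zero i + lc (λ j → y * c (suc j)) (g ∘ suc) i ∎
    where open ≡-Reasoning

  lc-zero : ∀ {k} (g : Fin k → V) i → lc (λ _ → 0#) g i ≡ 0#
  lc-zero {zero}  g i = refl
  lc-zero {suc k} g i = trans (0*x+y≡y (g zero i) _) (lc-zero (g ∘ suc) i)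

  basis : ∀ {k} → Fin k → Fin k → F
  basis zero    zero    = 1#
  basis zero    (suc _) = 0#
  basis (suc i) zero    = 0#
  basis (suc i) (suc j) = basis i j

  InSpan-self : ∀ {k} (g : Fin k → V) i → InSpan (g i) g
  InSpan-self g i = basis i , lc-basis g i
    where
    lc-basis : ∀ {k} (g : Fin k → V) i → g i ≗ lc (basis i) g
    lc-basis g zero x = sym (begin
      1# * g zero x + lc (λ _ → 0#) (g ∘ suc) x
        ≡⟨ cong₂ _+_ (*-identityˡ (g zero x)) (lc-zero (g ∘ suc) x) ⟩
      g zero x + 0#
        ≡⟨ +-identityʳ (g zero x) ⟩
      g zero x ∎)
      where open ≡-Reasoning
    lc-basis g (suc i) x = trans (lc-basis (g ∘ suc) i x) (sym (0*x+y≡y (g zero x) _))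

  CosetRank≥2 : ∀ {k} → V → (Fin k → V) → Set
  CosetRank≥2 X g = ∀ c → ¬ Minors2Zero (λ i → X i + lc c g i)

  module _ {k} {X : V} (g : Fin k → V) where

    lc-∷-head≡0 : ∀ c → c zero ≡ 0# → lc c (X ∷ᶠ g) ≗ lc (c ∘ suc) g
    lc-∷-head≡0 c c₀≡0 i = trans (cong (λ a → a * X i + lc (c ∘ suc) g i) c₀≡0) (0*x+y≡y _ _)

    lc-∷-rescale : ∀ y c → y * c zero ≡ 1# →
                   (λ i → y * lc c (X ∷ᶠ g) i) ≗ (λ i → X i + lc (λ j → y * c (suc j)) g i)
    lc-∷-rescale y c yc₀≡1 i = begin
      y * (c zero * X i + lc (c ∘ suc) g i)
        ≡⟨ distribˡ y _ _ ⟩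
      y * (c zero * X i) + y * lc (c ∘ suc) g i
        ≡⟨ cong₂ _+_ (sym (*-assoc y _ _)) (lc-scale y (c ∘ suc) g i) ⟩
      (y * c zero) * X i + lc (λ j → y * c (suc j)) g i
        ≡⟨ cong (λ a → a * X i + lc (λ j → y * c (suc j)) g i) yc₀≡1 ⟩
      1# * X i + lc (λ j → y * c (suc j)) g i
        ≡⟨ cong (_+ lc (λ j → y * c (suc j)) g i) (*-identityˡ (X i)) ⟩
      X i + lc (λ j → y * c (suc j)) g i ∎
      where open ≡-Reasoning

    CosetRank≥2⇒¬Minors2Zero : CosetRank≥2 X g → ∀ c → c zero ≢ 0# →
                               ¬ Minors2Zero (lc c (X ∷ᶠ g))
    CosetRank≥2⇒¬Minors2Zero coset c c₀≢0 m with inverse (c zero) c₀≢0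
    ... | y , c₀y≡1 = coset (λ j → y * c (suc j))
      (Minors2Zero-resp (lc-∷-rescale y c (trans (*-comm y _) c₀y≡1)) (Minors2Zero-scale y m))

    InSpan-∷ : ∀ {v} → InSpan v g → InSpan v (X ∷ᶠ g)
    InSpan-∷ (c , v≗lc) = 0# ∷ᶠ c , λ i → trans (v≗lc i) (sym (lc-∷-head≡0 (0# ∷ᶠ c) refl i))

    ∷-LinIndep : LinIndep g → CosetRank≥2 X g → LinIndep (X ∷ᶠ g)
    ∷-LinIndep indep coset c lc≡0 = λ where
        zero    → c₀≡0
        (suc j) → indep (c ∘ suc) (λ i → trans (sym (lc-∷-head≡0 c c₀≡0 i)) (lc≡0 i)) j
      where
      c₀≡0 : c zero ≡ 0#
      c₀≡0 with c zero ≟ 0#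
      ... | yes c₀≡0 = c₀≡0
      ... | no c₀≢0  = ⊥-elim (CosetRank≥2⇒¬Minors2Zero coset c c₀≢0 (zero⇒Minors2Zero lc≡0))

    ∷-MinRank2 : MinRank g 2 → CosetRank≥2 X g → MinRank (X ∷ᶠ g) 2
    ∷-MinRank2 (g-rank≥2 , c , nonzero , rank-c) coset = X∷g-rank≥2 , 0# ∷ᶠ c ,
      NonZero-resp (sym ∘ lc-∷-head≡0 (0# ∷ᶠ c) refl) nonzero ,
      Rank-resp (sym ∘ lc-∷-head≡0 (0# ∷ᶠ c) refl) rank-c
      where
      X∷g-rank≥2 : ∀ c r → NonZero (lc c (X ∷ᶠ g)) → Rank (lc c (X ∷ᶠ g)) r → 2 ≤ r
      X∷g-rank≥2 c r nonzero rank with c zero ≟ 0#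
      ... | yes c₀≡0 = g-rank≥2 (c ∘ suc) r (NonZero-resp (lc-∷-head≡0 c c₀≡0) nonzero)
                                            (Rank-resp (lc-∷-head≡0 c c₀≡0) rank)
      ... | no c₀≢0  = ¬Minors2Zero⇒rank≥2 (CosetRank≥2⇒¬Minors2Zero coset c c₀≢0) rank

  scaledSquare : F → F × F × F → V
  scaledSquare l (x , y , z) 0F = l * (x * x)
  scaledSquare l (x , y , z) 1F = l * (x * y)
  scaledSquare l (x , y , z) 2F = l * (x * z)
  scaledSquare l (x , y , z) 3F = l * (y * y)
  scaledSquare l (x , y , z) 4F = l * (y * z)
  scaledSquare l (x , y , z) 5F = l * (z * z)

  elems : List F
  elems = deduplicate _≟_ elements

  ∈-elems : ∀ x → x ∈ elems
  ∈-elems x = ∈-deduplicate⁺ _≟_ (complete x)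

  -- one representative, with first nonzero coordinate 1, of each point of PG(2, q)
  pivot₀ pivot₁ pivot₂ normalised : List (F × F × F)
  pivot₀ = cartesianProductWith (λ y z → 1# , y , z) elems elems
  pivot₁ = map (λ z → 0# , 1# , z) elems
  pivot₂ = (0# , 0# , 1#) ∷ []
  normalised = pivot₀ ++ pivot₁ ++ pivot₂

  unit-entry : ∀ l → l ≡ l * (1# * 1#)
  unit-entry = solve 1 (λ l → l := l :* (con 1 :* con 1)) refl

  vanishing-entry : ∀ {x} l z → x ≡ 0# → x ≡ l * (0# * z)
  vanishing-entry l z x≡0 = trans x≡0 (solve 2 (λ l z → con 0 := l :* (con 0 :* z)) refl l z)

  inverse-entry : ∀ {m m⁻¹} a → m * m⁻¹ ≡ 1# → a ≡ m * (1# * (a * m⁻¹))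
  inverse-entry {m} {m⁻¹} a mm⁻¹≡1 = sym (begin
    m * (1# * (a * m⁻¹))  ≡⟨ solve 3 (λ m n a → m :* (con 1 :* (a :* n)) := a :* (m :* n)) refl m m⁻¹ a ⟩
    a * (m * m⁻¹)         ≡⟨ cong (a *_) mm⁻¹≡1 ⟩
    a * 1#                ≡⟨ *-identityʳ a ⟩
    a                     ∎)
    where open ≡-Reasoning

  inverse-entry² : ∀ {m m⁻¹ t} a b → m * m⁻¹ ≡ 1# → m * t ≡ a * b →
                   t ≡ m * ((a * m⁻¹) * (b * m⁻¹))
  inverse-entry² {m} {m⁻¹} {t} a b mm⁻¹≡1 mt≡ab = sym (begin
    m * ((a * m⁻¹) * (b * m⁻¹))     ≡⟨ solve 4 (λ m m⁻¹ a b → m :* ((a :* m⁻¹) :* (b :* m⁻¹))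
                                                := (a :* b) :* (m :* (m⁻¹ :* m⁻¹))) refl m m⁻¹ a b ⟩
    (a * b) * (m * (m⁻¹ * m⁻¹))     ≡⟨ cong (_* (m * (m⁻¹ * m⁻¹))) mt≡ab ⟨
    (m * t) * (m * (m⁻¹ * m⁻¹))     ≡⟨ solve 3 (λ m m⁻¹ t → (m :* t) :* (m :* (m⁻¹ :* m⁻¹))
                                                := t :* ((m :* m⁻¹) :* (m :* m⁻¹))) refl m m⁻¹ t ⟩
    t * ((m * m⁻¹) * (m * m⁻¹))     ≡⟨ cong (λ u → t * (u * u)) mm⁻¹≡1 ⟩
    t * (1# * 1#)                   ≡⟨ unit-entry t ⟨
    t                               ∎)
    where open ≡-Reasoning

  IsScaledSquare : V → Set
  IsScaledSquare M = ∃₂ λ l w → w ∈ normalised × M ≗ scaledSquare l w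

  module _ {M : V} (m : Minors2Zero M) where

    private
      cross : ∀ i i' j j' → e M i j * e M i' j' ≡ e M i j' * e M i' j
      cross i i' j j' = x∙y⁻¹≈ε⇒x≈y _ _ (m i i' j j')

      M₀≢0⇒scaledSquare : M 0F ≢ 0# → IsScaledSquare M
      M₀≢0⇒scaledSquare M₀≢0 with inverse (M 0F) M₀≢0
      ... | M₀⁻¹ , M₀M₀⁻¹≡1 = M 0F , (1# , M 1F * M₀⁻¹ , M 2F * M₀⁻¹) ,
        ∈-++⁺ˡ (∈-cartesianProductWith⁺ _ (∈-elems _) (∈-elems _)) , λ where
          0F → unit-entry (M 0F)
          1F → inverse-entry (M 1F) M₀M₀⁻¹≡1
          2F → inverse-entry (M 2F) M₀M₀⁻¹≡1
          3F → inverse-entry² (M 1F) (M 1F) M₀M₀⁻¹≡1 (cross 0F 1F 0F 1F)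
          4F → inverse-entry² (M 1F) (M 2F) M₀M₀⁻¹≡1 (trans (cross 0F 1F 0F 2F) (*-comm _ _))
          5F → inverse-entry² (M 2F) (M 2F) M₀M₀⁻¹≡1 (cross 0F 2F 0F 2F)

      M₃≢0⇒scaledSquare : M 0F ≡ 0# → M 3F ≢ 0# → IsScaledSquare M
      M₃≢0⇒scaledSquare M₀≡0 M₃≢0 with inverse (M 3F) M₃≢0
      ... | M₃⁻¹ , M₃M₃⁻¹≡1 = M 3F , (0# , 1# , M 4F * M₃⁻¹) ,
        ∈-++⁺ʳ pivot₀ (∈-++⁺ˡ (∈-map⁺ _ (∈-elems _))) , λ where
          0F → vanishing-entry (M 3F) 0# M₀≡0
          1F → vanishing-entry (M 3F) 1# (ab≡cc⇒a≡0⇒c≡0 (cross 0F 1F 0F 1F) M₀≡0)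
          2F → vanishing-entry (M 3F) _ (ab≡cc⇒a≡0⇒c≡0 (cross 0F 2F 0F 2F) M₀≡0)
          3F → unit-entry (M 3F)
          4F → inverse-entry (M 4F) M₃M₃⁻¹≡1
          5F → inverse-entry² (M 4F) (M 4F) M₃M₃⁻¹≡1 (cross 1F 2F 1F 2F)

      M₅-only⇒scaledSquare : M 0F ≡ 0# → M 3F ≡ 0# → IsScaledSquare M
      M₅-only⇒scaledSquare M₀≡0 M₃≡0 = M 5F , (0# , 0# , 1#) ,
        ∈-++⁺ʳ pivot₀ (∈-++⁺ʳ pivot₁ (here refl)) , λ where
        0F → vanishing-entry (M 5F) 0# M₀≡0
        1F → vanishing-entry (M 5F) 0# (ab≡cc⇒a≡0⇒c≡0 (cross 0F 1F 0F 1F) M₀≡0)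
        2F → vanishing-entry (M 5F) 1# (ab≡cc⇒a≡0⇒c≡0 (cross 0F 2F 0F 2F) M₀≡0)
        3F → vanishing-entry (M 5F) 0# M₃≡0
        4F → vanishing-entry (M 5F) 1# (ab≡cc⇒a≡0⇒c≡0 (cross 1F 2F 1F 2F) M₃≡0)
        5F → unit-entry (M 5F)

    Minors2Zero⇒scaledSquare : IsScaledSquare M
    Minors2Zero⇒scaledSquare with M 0F ≟ 0# | M 3F ≟ 0#
    ... | no M₀≢0 | _        = M₀≢0⇒scaledSquare M₀≢0
    ... | yes M₀≡0 | no M₃≢0  = M₃≢0⇒scaledSquare M₀≡0 M₃≢0
    ... | yes M₀≡0 | yes M₃≡0 = M₅-only⇒scaledSquare M₀≡0 M₃≡0

  q : ℕ
  q = length elems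

  2≤q : 2 ≤ q
  2≤q = Unique-⊆⇒length-≤ {xs = 0# ∷ 1# ∷ []} ((0≢1 All.∷ All.[]) ∷ All.[] ∷ []) λ where
    (here refl)         → ∈-elems 0#
    (there (here refl)) → ∈-elems 1#

  length-normalised : length normalised ≡ q Nat.* q Nat.+ (q Nat.+ 1)
  length-normalised = begin
    length (pivot₀ ++ pivot₁ ++ pivot₂)
      ≡⟨ length-++ pivot₀ ⟩
    length pivot₀ Nat.+ length (pivot₁ ++ pivot₂)
      ≡⟨ cong (length pivot₀ Nat.+_) (length-++ pivot₁) ⟩
    length pivot₀ Nat.+ (length pivot₁ Nat.+ 1)
      ≡⟨ cong₂ (λ a b → a Nat.+ (b Nat.+ 1)) (length-cartesianProductWith _ elems elems) (length-map _ elems) ⟩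
    q Nat.* q Nat.+ (q Nat.+ 1) ∎
    where open ≡-Reasoning

  Minors2Zero? : ∀ v → Dec (Minors2Zero v)
  Minors2Zero? v = all? λ i → all? λ i' → all? λ j → all? λ j' → minor2 v i i' j j' ≟ 0#

  rank≤1-matrices : List V
  rank≤1-matrices = cartesianProductWith scaledSquare elems normalised

  -- Matrices are enumerated as Vec F 6, whose equality, unlike that of V, is pointwise.
  module _ {k} (g : Fin k → V) where

    Bad : Vec F 6 → Set
    Bad X = Any (λ c → Minors2Zero (λ i → lookup X i + lc (lookup c) g i)) (vectors elems k)

    rank≤1-translates : List (Vec F 6)
    rank≤1-translates = cartesianProductWith (λ R c → tabulate (λ i → R i + - lc (lookup c) g i))
                          rank≤1-matrices (vectors elems k)

    length-rank≤1-translates :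
      length rank≤1-translates ≡ q Nat.* (q Nat.* q Nat.+ (q Nat.+ 1)) Nat.* q Nat.^ k
    length-rank≤1-translates = begin
      length rank≤1-translates
        ≡⟨ length-cartesianProductWith _ rank≤1-matrices (vectors elems k) ⟩
      length rank≤1-matrices Nat.* length (vectors elems k)
        ≡⟨ cong₂ Nat._*_ (trans (length-cartesianProductWith scaledSquare elems normalised)
                                (cong (q Nat.*_) length-normalised))
                         (length-vectors elems k) ⟩
      q Nat.* (q Nat.* q Nat.+ (q Nat.+ 1)) Nat.* q Nat.^ k ∎
      where open ≡-Reasoning

    Bad? : ∀ X → Dec (Bad X)
    Bad? X = any? (λ c → Minors2Zero? _) (vectors elems k)

    Bad⇒∈rank≤1-translates : ∀ X → Bad X → X ∈ rank≤1-translates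
    Bad⇒∈rank≤1-translates X bad with find bad
    ... | c , c∈ , m with Minors2Zero⇒scaledSquare m
    ...   | l , w , w∈ , M≗lw = subst (_∈ rank≤1-translates) translate≡X
      (∈-cartesianProductWith⁺ _ (∈-cartesianProductWith⁺ scaledSquare (∈-elems l) w∈) c∈)
      where
      translate≡X : tabulate (λ i → scaledSquare l w i + - lc (lookup c) g i) ≡ X
      translate≡X = trans (tabulate-cong λ i →
          trans (cong (_+ - lc (lookup c) g i) (sym (M≗lw i)))
                (//-rightDividesʳ (lc (lookup c) g i) (lookup X i)))
        (tabulate∘lookup X)

    ¬All-Bad : k ≤ 2 → ¬ All Bad (vectors elems 6)
    ¬All-Bad k≤2 allBad = ℕₚ.<⇒≱ (q³+q²+q·qᵏ<q⁶ 2≤q k≤2)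
      (subst₂ _≤_ (length-vectors elems 6) length-rank≤1-translates
        (Unique-⊆⇒length-≤ (vectors-unique elems (deduplicate-! _≟_ elements) 6)
          (λ X∈ → Bad⇒∈rank≤1-translates _ (All.lookup allBad X∈))))

  exists-CosetRank≥2 : ∀ {k} (g : Fin k → V) → k ≤ 2 → ∃ λ X → CosetRank≥2 X g
  exists-CosetRank≥2 g k≤2 with satisfied (¬All⇒Any¬ (Bad? g) _ (¬All-Bad g k≤2))
  ... | X , ¬bad = lookup X , λ c m → ¬bad (lose (∈-vectors elems ∈-elems (tabulate c))
    (Minors2Zero-resp (λ i → cong (lookup X i +_) (lc-cong g (sym ∘ lookup∘tabulate c) i)) m))

lemma3p14 : (K : FiniteField) (L : Fin 2 → Over.V K) →
    Over.LinIndep K L → Over.MinRank K L 2 →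
    ∃ λ (P : Fin 3 → Over.V K) →
      Over.LinIndep K P × (∀ i → Over.InSpan K (L i) P) × Over.MinRank K P 2
lemma3p14 K L indep minRank2 =
  let X , coset = exists-CosetRank≥2 K L ℕₚ.≤-refl
  in  X ∷ᶠ L ,
      ∷-LinIndep K L indep coset ,
      (λ i → InSpan-∷ K L (InSpan-self K L i)) ,
      ∷-MinRank2 K L minRank2 coset
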